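{- For all integers $2\le n\le m$, \[ \gamma_{2t}(K_n\Box K_m)\le \gamma_{2t}(K_n\Box K_{m+1})\le \gamma_{2t}(K_n\Box K_m)+1 \] and \[ \gamma_{2t}(K_n\Box K_m)\le \gamma_{2t}(K_{n+1}\Box K_{m})\le \gamma_{2t}(K_n\Box K_m)+2. \]
   Context: $K_n$ denotes the complete graph on $n$ vertices. The Cartesian product $G\Box H$ has vertex set $V(G)\times V(H)$, with $(u_1,v_1)\sim(u_2,v_2)$ iff either $u_1=u_2$ and $v_1\sim v_2$, or $v_1=v_2$ and $u_1\sim u_2$. A set $S$ of vertices of a graph $G$ is total $2$-dominating if every vertex of $G$ is adjacent to at least two vertices of $S$; $\gamma_{2t}(G)$ is the minimum cardinality of such a set. -}

module Defs where

open import Data.Nat using (ℕ; _≤_)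
open import Data.Fin using (Fin)
open import Data.Product using (_×_; Σ; ∃; ∃₂; _,_)
open import Data.Sum using (_⊎_)
open import Data.List using (List; length)
open import Data.List.Membership.Propositional using (_∈_)
open import Data.List.Relation.Unary.Unique.Propositional using (Unique)
open import Relation.Binary.PropositionalEquality using (_≡_; _≢_)

V : ℕ → ℕ → Set
V n m = Fin n × Fin m

Adj : ∀ {n m} → V n m → V n m → Set
Adj (a , b) (c , d) = (a ≡ c × b ≢ d) ⊎ (b ≡ d × a ≢ c)

IsTotal2Dom : ∀ n m → List (V n m) → Set
IsTotal2Dom n m S =
  ∀ (x : V n m) → ∃₂ λ (u v : V n m) →
    u ≢ v × u ∈ S × v ∈ S × Adj x u × Adj x v

IsGamma2t : ℕ → ℕ → ℕ → Set
IsGamma2t n m k =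
  (Σ (List (V n m)) λ S → Unique S × IsTotal2Dom n m S × length S ≡ k)
  × (∀ (S : List (V n m)) → Unique S → IsTotal2Dom n m S → k ≤ length S)

-- Write r i and c j for the number of elements of S in row i and column j.  The vertex (i , j)
-- has r i + c j − 2 [(i , j) ∈ S] neighbours in S, so total 2-domination is a family of
-- inequalities between these counts.  Merging two columns that share no occupied row preserves
-- them.  A column with at most one element can be merged with another one unless the row of its
-- element is full, and then |S| ≥ n + m; without such a column |S| ≥ 2 (m + 1).  As two full
-- columns give γ ≤ 2n, this proves monotonicity in m, and in n by transposition.  Conversely,
-- a new row holding two elements in two occupied columns, or a new column holding one element in
-- a row with r i ≥ 2, keeps the inequalities; if no row has r i ≥ 2, then either some row is
-- empty, which forces |S| ≥ 2m, or every row has exactly one element, which the inequalities forbid.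

module Submission where

open import Defs
open import Data.Nat.Properties hiding (_≟_)
open import Algebra.Properties.CommutativeSemigroup +-commutativeSemigroup
  using () renaming (interchange to +-interchange)
open import Algebra.Properties.CommutativeSemigroup *-commutativeSemigroup
  using () renaming (x∙yz≈y∙xz to x*[y*z]≡y*[x*z])
open import Algebra.Properties.Semiring.Sum +-*-semiring
  using (sum; sum-remove; ∑-distrib-+; *-distribˡ-sum; *-distribʳ-sum; sum-replicate-zero)
open import Data.Bool using (if_then_else_)
open import Data.Empty using (⊥; ⊥-elim)
open import Data.Fin using (Fin; zero; suc; punchIn; punchOut)
open import Data.Fin.Properties
  using (_≟_; any?; all?; ¬∀⟶∃¬; punchInᵢ≢i; punchIn-injective; punchIn-punchOut; punchOut-injective)
open import Data.List using (List; []; _∷_; length; map; _++_; allFin)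
open import Data.List.Membership.Propositional using (_∈_)
open import Data.List.Membership.Propositional.Properties using (∈-map⁺; ∈-map⁻; ∈-++⁺ˡ; ∈-++⁺ʳ; ∈-allFin)
open import Data.List.Properties using (length-map; length-++; length-tabulate)
open import Data.List.Relation.Unary.All using (All; []; _∷_; lookup; universal)
import Data.List.Relation.Unary.All.Properties as All
open import Data.List.Relation.Unary.AllPairs using ([]; _∷_)
open import Data.List.Relation.Unary.Any using (here; there)
open import Data.List.Relation.Unary.Unique.Propositional using (Unique)
import Data.List.Relation.Unary.Unique.Propositional.Properties as Unique
import Data.Nat as ℕ
open import Data.Nat using (ℕ; zero; suc; _+_; _*_; _≤_; _≤?_; z≤n; s≤s; s≤s⁻¹)
open import Data.Product using (_×_; Σ; ∃; ∃₂; _,_; proj₁; proj₂; swap; map₁; map₂)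
open import Data.Sum as Sum using (_⊎_; inj₁; inj₂; [_,_]′)
open import Function using (_∘_; id)
open import Relation.Binary.PropositionalEquality
open import Relation.Nullary using (¬_; Dec; yes; no; does; contradiction)
open import Relation.Nullary.Decidable using (_×-dec_; _⊎-dec_; ¬?)

𝟙 : ∀ {p} {P : Set p} → Dec P → ℕ
𝟙 P? = if does P? then 1 else 0

module _ {p} {P : Set p} where

  𝟙-yes : (P? : Dec P) → P → 𝟙 P? ≡ 1
  𝟙-yes (yes _) _  = refl
  𝟙-yes (no ¬p) p  = contradiction p ¬p

  𝟙-no : (P? : Dec P) → ¬ P → 𝟙 P? ≡ 0
  𝟙-no (yes p) ¬p = contradiction p ¬p
  𝟙-no (no _)  _  = refl

  𝟙≤1 : (P? : Dec P) → 𝟙 P? ≤ 1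
  𝟙≤1 (yes _) = ≤-refl
  𝟙≤1 (no _)  = z≤n

  𝟙-pos : (P? : Dec P) → 1 ≤ 𝟙 P? → P
  𝟙-pos (yes p) _ = p
  𝟙-pos (no _)  ()

  𝟙-⇔ : ∀ {q} {Q : Set q} → (P → Q) → (Q → P) → (P? : Dec P) (Q? : Dec Q) → 𝟙 P? ≡ 𝟙 Q?
  𝟙-⇔ P→Q Q→P P? Q? with P? | Q?
  ... | yes _ | yes _ = refl
  ... | yes p | no ¬q = contradiction (P→Q p) ¬q
  ... | no ¬p | yes q = contradiction (Q→P q) ¬p
  ... | no _  | no _  = refl

δ : ∀ {k} → Fin k → Fin k → ℕ
δ i j = 𝟙 (i ≟ j)

δ-refl : ∀ {k} (i : Fin k) → δ i i ≡ 1
δ-refl i = 𝟙-yes (i ≟ i) refl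

δ-≢ : ∀ {k} {i j : Fin k} → i ≢ j → δ i j ≡ 0
δ-≢ {i = i} {j} = 𝟙-no (i ≟ j)

δ-punchOut : ∀ {k} {i j : Fin (suc k)} (i≢j : i ≢ j) (l : Fin k) → δ (punchOut i≢j) l ≡ δ j (punchIn i l)
δ-punchOut {i = i} {j} i≢j l = 𝟙-⇔ to from (punchOut i≢j ≟ l) (j ≟ punchIn i l)
  where
  to : punchOut i≢j ≡ l → j ≡ punchIn i l
  to eq = trans (sym (punchIn-punchOut i≢j)) (cong (punchIn i) eq)
  from : j ≡ punchIn i l → punchOut i≢j ≡ l
  from eq = punchIn-injective i _ _ (trans (punchIn-punchOut i≢j) eq)

sum-δ : ∀ {k} (i : Fin k) → sum (δ i) ≡ 1
sum-δ {suc k} zero    = cong suc (sum-replicate-zero k)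
sum-δ         (suc i) = sum-δ i

∑ : ∀ {A : Set} → List A → (A → ℕ) → ℕ
∑ []      h = 0
∑ (u ∷ S) h = h u + ∑ S h

module _ {A : Set} where

  ∑-cong : ∀ S {h k : A → ℕ} → (∀ u → h u ≡ k u) → ∑ S h ≡ ∑ S k
  ∑-cong []      h≗k = refl
  ∑-cong (u ∷ S) h≗k = cong₂ _+_ (h≗k u) (∑-cong S h≗k)

  ∑-+ : ∀ S (h k : A → ℕ) → ∑ S (λ u → h u + k u) ≡ ∑ S h + ∑ S k
  ∑-+ []      h k = refl
  ∑-+ (u ∷ S) h k = trans (cong (h u + k u +_) (∑-+ S h k)) (+-interchange (h u) (k u) (∑ S h) (∑ S k))

  ∑-*ˡ : ∀ S c (h : A → ℕ) → ∑ S (λ u → c * h u) ≡ c * ∑ S h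
  ∑-*ˡ []      c h = sym (*-zeroʳ c)
  ∑-*ˡ (u ∷ S) c h = trans (cong (c * h u +_) (∑-*ˡ S c h)) (sym (*-distribˡ-+ c (h u) (∑ S h)))

  ∑-zero : ∀ (S : List A) → ∑ S (λ _ → 0) ≡ 0
  ∑-zero []      = refl
  ∑-zero (_ ∷ S) = ∑-zero S

  ∑-one : ∀ (S : List A) → ∑ S (λ _ → 1) ≡ length S
  ∑-one []      = refl
  ∑-one (_ ∷ S) = cong suc (∑-one S)

  ∑-map : ∀ {B : Set} (f : B → A) S (h : A → ℕ) → ∑ (map f S) h ≡ ∑ S (h ∘ f)
  ∑-map f []      h = refl
  ∑-map f (u ∷ S) h = cong (h (f u) +_) (∑-map f S h)

  member≤∑ : ∀ (h : A → ℕ) {S u} → u ∈ S → h u ≤ ∑ S h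
  member≤∑ h {u ∷ S} (here refl) = m≤m+n (h u) (∑ S h)
  member≤∑ h {w ∷ S} (there u∈S) = ≤-trans (member≤∑ h u∈S) (m≤n+m (∑ S h) (h w))

  2≤∑-of-two-members : ∀ (h : A → ℕ) {S u v} → u ≢ v → u ∈ S → v ∈ S →
                       1 ≤ h u → 1 ≤ h v → 2 ≤ ∑ S h
  2≤∑-of-two-members h u≢v (here refl) (here refl) _ _ = contradiction refl u≢v
  2≤∑-of-two-members h {w ∷ S} u≢v (here refl) (there v∈S) hu hv = +-mono-≤ hu (≤-trans hv (member≤∑ h v∈S))
  2≤∑-of-two-members h {w ∷ S} u≢v (there u∈S) (here refl) hu hv = +-mono-≤ hv (≤-trans hu (member≤∑ h u∈S))
  2≤∑-of-two-members h {w ∷ S} u≢v (there u∈S) (there v∈S) hu hv =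
    ≤-trans (2≤∑-of-two-members h u≢v u∈S v∈S hu hv) (m≤n+m (∑ S h) (h w))

  positive-member : ∀ (h : A → ℕ) S → 1 ≤ ∑ S h → ∃ λ u → u ∈ S × 1 ≤ h u
  positive-member h (u ∷ S) 1≤∑ with 1 ≤? h u
  ... | yes 1≤hu = u , here refl , 1≤hu
  ... | no  1≰hu with positive-member h S (subst (λ x → 1 ≤ x + ∑ S h) (n<1⇒n≡0 (≰⇒> 1≰hu)) 1≤∑)
  ...   | v , v∈S , 1≤hv = v , there v∈S , 1≤hv

  two-positive-members : ∀ (h : A → ℕ) S → Unique S → (∀ u → h u ≤ 1) → 2 ≤ ∑ S h →
            ∃₂ λ u v → u ≢ v × u ∈ S × v ∈ S × 1 ≤ h u × 1 ≤ h v
  two-positive-members h (u ∷ S) (u∉S ∷ unique) h≤1 2≤∑ with 1 ≤? h u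
  ... | yes 1≤hu =
    let v , v∈S , 1≤hv = positive-member h S (s≤s⁻¹ (≤-trans 2≤∑ (+-monoˡ-≤ (∑ S h) (h≤1 u))))
    in u , v , lookup u∉S v∈S , here refl , there v∈S , 1≤hu , 1≤hv
  ... | no 1≰hu
    with two-positive-members h S unique h≤1 (subst (λ x → 2 ≤ x + ∑ S h) (n<1⇒n≡0 (≰⇒> 1≰hu)) 2≤∑)
  ...   | v , w , v≢w , v∈S , w∈S , 1≤hv , 1≤hw = v , w , v≢w , there v∈S , there w∈S , 1≤hv , 1≤hw

  map⁺-injectiveOn : ∀ {B : Set} (f : A → B) S → Unique S →
               (∀ {x y} → x ∈ S → y ∈ S → f x ≡ f y → x ≡ y) → Unique (map f S)
  map⁺-injectiveOn f []      []              _   = []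
  map⁺-injectiveOn f (u ∷ S) (u∉S ∷ unique) inj =
    distinct S u∉S (λ v∈S → v∈S) ∷ map⁺-injectiveOn f S unique (λ x∈S y∈S → inj (there x∈S) (there y∈S))
    where
    distinct : ∀ T → All (u ≢_) T → (∀ {v} → v ∈ T → v ∈ S) → All (f u ≢_) (map f T)
    distinct []      _            _    = []
    distinct (v ∷ T) (u≢v ∷ u∉T) T⊆S =
      (λ fu≡fv → u≢v (inj (here refl) (there (T⊆S (here refl))) fu≡fv)) ∷ distinct T u∉T (T⊆S ∘ there)

sum-∑-comm : ∀ {A : Set} {k} (S : List A) (h : Fin k → A → ℕ) →
             sum (λ i → ∑ S (h i)) ≡ ∑ S (λ u → sum (λ i → h i u))
sum-∑-comm {k = k} []      h = sum-replicate-zero k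
sum-∑-comm         (u ∷ S) h =
  trans (∑-distrib-+ (λ i → h i u) (λ i → ∑ S (h i))) (cong (sum (λ i → h i u) +_) (sum-∑-comm S h))

k*c≤sum : ∀ {k c} {f : Fin k → ℕ} → (∀ i → c ≤ f i) → k * c ≤ sum f
k*c≤sum {zero}  _   = z≤n
k*c≤sum {suc k} c≤f = +-mono-≤ (c≤f zero) (k*c≤sum (c≤f ∘ suc))

sum≤k*c : ∀ {k c} {f : Fin k → ℕ} → (∀ i → f i ≤ c) → sum f ≤ k * c
sum≤k*c {zero}  _   = z≤n
sum≤k*c {suc k} f≤c = +-mono-≤ (f≤c zero) (sum≤k*c (f≤c ∘ suc))

k≤sum : ∀ {k} {f : Fin k → ℕ} → (∀ i → 1 ≤ f i) → k ≤ sum f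
k≤sum {k} {f} 1≤f = subst (_≤ sum f) (*-identityʳ k) (k*c≤sum 1≤f)

k+k≤sum : ∀ {k} {f : Fin k → ℕ} → (∀ i → 2 ≤ f i) → k + k ≤ sum f
k+k≤sum {k} {f} 2≤f = subst (_≤ sum f) k*2≡k+k (k*c≤sum 2≤f)
  where
  k*2≡k+k : k * 2 ≡ k + k
  k*2≡k+k = trans (*-comm k 2) (cong (k +_) (+-identityʳ k))

sum≤k : ∀ {k} {f : Fin k → ℕ} → (∀ i → f i ≤ 1) → sum f ≤ k
sum≤k {k} {f} f≤1 = subst (sum f ≤_) (*-identityʳ k) (sum≤k*c f≤1)

entry≤sum : ∀ {k} (f : Fin k → ℕ) i → f i ≤ sum f
entry≤sum {suc k} f i = subst (f i ≤_) (sym (sum-remove f)) (m≤m+n (f i) _)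

c+k≤sum : ∀ {k c} (f : Fin (suc k) → ℕ) i → c ≤ f i → (∀ j → 1 ≤ f (punchIn i j)) → c + k ≤ sum f
c+k≤sum {k} {c} f i c≤fi 1≤rest = subst (c + k ≤_) (sym (sum-remove f)) (+-mono-≤ c≤fi (k≤sum 1≤rest))

entry+entry≤sum : ∀ {k} (f : Fin k → ℕ) {i j} → i ≢ j → f i + f j ≤ sum f
entry+entry≤sum {suc k} f {i} {j} i≢j =
  subst (f i + f j ≤_) (sym (sum-remove f))
    (+-monoʳ-≤ (f i) (subst (_≤ sum (f ∘ punchIn i)) (cong f (punchIn-punchOut i≢j))
                         (entry≤sum (f ∘ punchIn i) (punchOut i≢j))))

positive-entry : ∀ {k} (f : Fin k → ℕ) → 1 ≤ sum f → ∃ λ i → 1 ≤ f i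
positive-entry {k} f 1≤sum with any? (λ i → 1 ≤? f i)
... | yes found = found
... | no  none  = ⊥-elim (1+n≰n (≤-trans 1≤sum (subst (sum f ≤_) (*-zeroʳ k) (sum≤k*c f≤0))))
  where
  f≤0 : ∀ i → f i ≤ 0
  f≤0 i = ≤-reflexive (n<1⇒n≡0 (≰⇒> (λ 1≤fi → none (i , 1≤fi))))

module _ {a b : ℕ} where

  rowCount : List (V a b) → Fin a → ℕ
  rowCount S i = ∑ S (λ u → δ (proj₁ u) i)

  colCount : List (V a b) → Fin b → ℕ
  colCount S j = ∑ S (λ u → δ (proj₂ u) j)

  mult : List (V a b) → Fin a → Fin b → ℕ
  mult S i j = ∑ S (λ u → δ (proj₁ u) i * δ (proj₂ u) j)

  Total2DomCounts : List (V a b) → Set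
  Total2DomCounts S = ∀ i j → 2 + (mult S i j + mult S i j) ≤ rowCount S i + colCount S j

  length-rows : ∀ S → length S ≡ sum (rowCount S)
  length-rows S = sym (trans (sum-∑-comm S λ i u → δ (proj₁ u) i) (trans (∑-cong S (sum-δ ∘ proj₁)) (∑-one S)))

  length-cols : ∀ S → length S ≡ sum (colCount S)
  length-cols S = sym (trans (sum-∑-comm S λ j u → δ (proj₂ u) j) (trans (∑-cong S (sum-δ ∘ proj₂)) (∑-one S)))

  rowCount-as-sum : ∀ S i → rowCount S i ≡ sum (mult S i)
  rowCount-as-sum S i = sym (trans (sum-∑-comm S λ j u → δ (proj₁ u) i * δ (proj₂ u) j) (∑-cong S row))
    where
    row : ∀ (u : V a b) → sum (λ j → δ (proj₁ u) i * δ (proj₂ u) j) ≡ δ (proj₁ u) i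
    row (p , q) = trans (sym (*-distribˡ-sum (δ p i) (δ q))) (trans (cong (δ p i *_) (sum-δ q)) (*-identityʳ _))

  colCount-as-sum : ∀ S j → colCount S j ≡ sum (λ i → mult S i j)
  colCount-as-sum S j = sym (trans (sum-∑-comm S λ i u → δ (proj₁ u) i * δ (proj₂ u) j) (∑-cong S col))
    where
    col : ∀ (u : V a b) → sum (λ i → δ (proj₁ u) i * δ (proj₂ u) j) ≡ δ (proj₂ u) j
    col (p , q) = trans (sym (*-distribʳ-sum (δ q j) (δ p))) (trans (cong (_* δ q j) (sum-δ p)) (*-identityˡ _))

  mult≤colCount : ∀ S i j → mult S i j ≤ colCount S j
  mult≤colCount S i j = subst (mult S i j ≤_) (sym (colCount-as-sum S j)) (entry≤sum (λ i → mult S i j) i)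

  mult-∈ : ∀ {S w} → w ∈ S → 1 ≤ mult S (proj₁ w) (proj₂ w)
  mult-∈ {S} {p , q} w∈S =
    subst (_≤ mult S p q) (cong₂ _*_ (δ-refl p) (δ-refl q))
      (member≤∑ (λ u → δ (proj₁ u) p * δ (proj₂ u) q) w∈S)

  colCount-∈ : ∀ {S w} → w ∈ S → 1 ≤ colCount S (proj₂ w)
  colCount-∈ {S} {p , q} w∈S = subst (_≤ colCount S q) (δ-refl q) (member≤∑ (λ u → δ (proj₂ u) q) w∈S)

  2≤row+col : ∀ S → Total2DomCounts S → ∀ i j → 2 ≤ rowCount S i + colCount S j
  2≤row+col S counts i j = ≤-trans (m≤m+n 2 _) (counts i j)

  Adj? : (x u : V a b) → Dec (Adj x u)
  Adj? (i , j) (p , q) = ((i ≟ p) ×-dec ¬? (j ≟ q)) ⊎-dec ((j ≟ q) ×-dec ¬? (i ≟ p))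

  neighbours : List (V a b) → V a b → ℕ
  neighbours S x = ∑ S (λ u → 𝟙 (Adj? x u))

  neighbours+2mult : ∀ S i j → neighbours S (i , j) + (mult S i j + mult S i j) ≡ rowCount S i + colCount S j
  neighbours+2mult S i j = begin
    neighbours S (i , j) + (mult S i j + mult S i j)
      ≡⟨ cong (neighbours S (i , j) +_) (∑-+ S m m) ⟨
    neighbours S (i , j) + ∑ S (λ u → m u + m u)
      ≡⟨ ∑-+ S (λ u → 𝟙 (Adj? (i , j) u)) (λ u → m u + m u) ⟨
    ∑ S (λ u → 𝟙 (Adj? (i , j) u) + (m u + m u))
      ≡⟨ ∑-cong S indicator ⟩
    ∑ S (λ u → δ (proj₁ u) i + δ (proj₂ u) j)
      ≡⟨ ∑-+ S (λ u → δ (proj₁ u) i) (λ u → δ (proj₂ u) j) ⟩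
    rowCount S i + colCount S j ∎
    where
    open ≡-Reasoning
    m : V a b → ℕ
    m u = δ (proj₁ u) i * δ (proj₂ u) j
    indicator : ∀ u → 𝟙 (Adj? (i , j) u) + (m u + m u) ≡ δ (proj₁ u) i + δ (proj₂ u) j
    indicator (p , q) with p ≟ i | q ≟ j
    ... | yes refl | yes refl =
      cong (_+ 2) (𝟙-no (Adj? (i , j) (i , j)) λ { (inj₁ (_ , j≢j)) → j≢j refl ; (inj₂ (_ , i≢i)) → i≢i refl })
    ... | yes refl | no q≢j = cong (_+ 0) (𝟙-yes (Adj? (i , j) (i , q)) (inj₁ (refl , q≢j ∘ sym)))
    ... | no p≢i | yes refl = cong (_+ 0) (𝟙-yes (Adj? (i , j) (p , j)) (inj₂ (refl , p≢i ∘ sym)))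
    ... | no p≢i | no q≢j =
      cong (_+ 0) (𝟙-no (Adj? (i , j) (p , q))
        λ { (inj₁ (i≡p , _)) → p≢i (sym i≡p) ; (inj₂ (j≡q , _)) → q≢j (sym j≡q) })

  T2D⇒counts : ∀ S → IsTotal2Dom a b S → Total2DomCounts S
  T2D⇒counts S t2d i j with t2d (i , j)
  ... | u , v , u≢v , u∈S , v∈S , adj-u , adj-v =
    subst (2 + (mult S i j + mult S i j) ≤_) (neighbours+2mult S i j)
      (+-monoˡ-≤ (mult S i j + mult S i j)
        (2≤∑-of-two-members (λ w → 𝟙 (Adj? (i , j) w)) u≢v u∈S v∈S
          (≤-reflexive (sym (𝟙-yes (Adj? (i , j) u) adj-u))) (≤-reflexive (sym (𝟙-yes (Adj? (i , j) v) adj-v)))))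

  counts⇒2≤neighbours : ∀ S → Total2DomCounts S → ∀ i j → 2 ≤ neighbours S (i , j)
  counts⇒2≤neighbours S counts i j =
    +-cancelʳ-≤ (mult S i j + mult S i j) 2 (neighbours S (i , j))
      (subst (2 + (mult S i j + mult S i j) ≤_) (sym (neighbours+2mult S i j)) (counts i j))

  counts⇒T2D : ∀ S → Unique S → Total2DomCounts S → IsTotal2Dom a b S
  counts⇒T2D S unique counts (i , j) =
    let u , v , u≢v , u∈S , v∈S , 1≤u , 1≤v =
          two-positive-members (λ w → 𝟙 (Adj? (i , j) w)) S unique (λ w → 𝟙≤1 (Adj? (i , j) w))
            (counts⇒2≤neighbours S counts i j)
    in u , v , u≢v , u∈S , v∈S , 𝟙-pos (Adj? (i , j) u) 1≤u , 𝟙-pos (Adj? (i , j) v) 1≤v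

Total2DomOfSize : ℕ → ℕ → ℕ → Set
Total2DomOfSize a b k = Σ (List (V a b)) λ T → Unique T × IsTotal2Dom a b T × length T ≡ k

fromCounts : ∀ {a b k} (T : List (V a b)) → Unique T → Total2DomCounts T → length T ≡ k → Total2DomOfSize a b k
fromCounts T unique counts size = T , unique , counts⇒T2D T unique counts , size

transpose : ∀ {a b k} → Total2DomOfSize a b k → Total2DomOfSize b a k
transpose {a} {b} (S , unique , t2d , refl) =
  map swap S , Unique.map⁺ (cong swap) unique , t2d-swap , length-map swap S
  where
  t2d-swap : IsTotal2Dom b a (map swap S)
  t2d-swap (j , i) with t2d (i , j)
  ... | u , v , u≢v , u∈S , v∈S , adj-u , adj-v =
    swap u , swap v , u≢v ∘ cong swap , ∈-map⁺ swap u∈S , ∈-map⁺ swap v∈S , Sum.swap adj-u , Sum.swap adj-v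

twoFullColumns : ∀ a b → Total2DomOfSize (suc (suc a)) (suc (suc b)) (suc (suc a) + suc (suc a))
twoFullColumns a b = T , unique , t2d , size
  where
  n : ℕ
  n = suc (suc a)
  column₀ column₁ : List (V n (suc (suc b)))
  column₀ = map (_, zero) (allFin n)
  column₁ = map (_, suc zero) (allFin n)
  T : List (V n (suc (suc b)))
  T = column₀ ++ column₁
  unique : Unique T
  unique = Unique.++⁺ (Unique.map⁺ (cong proj₁) (Unique.allFin⁺ n)) (Unique.map⁺ (cong proj₁) (Unique.allFin⁺ n))
             λ (x∈₀ , x∈₁) → different-columns (∈-map⁻ _ x∈₀) (∈-map⁻ _ x∈₁)
    where
    different-columns : ∀ {x} → ∃ (λ i → i ∈ allFin n × x ≡ (i , zero)) →
                        ∃ (λ i → i ∈ allFin n × x ≡ (i , suc zero)) → ⊥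
    different-columns (_ , _ , refl) (_ , _ , ())
  ∈₀ : ∀ i → (i , zero) ∈ T
  ∈₀ i = ∈-++⁺ˡ (∈-map⁺ (_, zero) (∈-allFin i))
  ∈₁ : ∀ i → (i , suc zero) ∈ T
  ∈₁ i = ∈-++⁺ʳ column₀ (∈-map⁺ (_, suc zero) (∈-allFin i))
  t2d : IsTotal2Dom n (suc (suc b)) T
  t2d (i , zero) =
    (i , suc zero) , (punchIn i zero , zero) , (λ ()) , ∈₁ i , ∈₀ (punchIn i zero) ,
    inj₁ (refl , λ ()) , inj₂ (refl , punchInᵢ≢i i zero ∘ sym)
  t2d (i , suc zero) =
    (i , zero) , (punchIn i zero , suc zero) , (λ ()) , ∈₀ i , ∈₁ (punchIn i zero) ,
    inj₁ (refl , λ ()) , inj₂ (refl , punchInᵢ≢i i zero ∘ sym)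
  t2d (i , suc (suc j)) =
    (i , zero) , (i , suc zero) , (λ ()) , ∈₀ i , ∈₁ i , inj₁ (refl , λ ()) , inj₁ (refl , λ ())
  size : length T ≡ n + n
  size = trans (length-++ column₀) (cong₂ _+_ (trans (length-map _ (allFin n)) (length-tabulate id))
                                            (trans (length-map _ (allFin n)) (length-tabulate id)))

RowDisjoint : ∀ {a b} → List (V a b) → Fin b → Fin b → Set
RowDisjoint S j₁ j₂ = ∀ i → mult S i j₁ ≡ 0 ⊎ mult S i j₂ ≡ 0

-- Deletes column j, sending its vertices to column t of the remaining ones (column punchIn j t before deletion).
mergeColumn : ∀ {b} → Fin (suc b) → Fin b → Fin (suc b) → Fin b
mergeColumn j t q with j ≟ q
... | yes _   = t
... | no j≢q  = punchOut j≢q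

module _ {b : ℕ} (j : Fin (suc b)) (t : Fin b) where

  δ-mergeColumn : ∀ q l → δ (mergeColumn j t q) l ≡ δ q (punchIn j l) + δ t l * δ q j
  δ-mergeColumn q l with j ≟ q
  ... | yes refl rewrite δ-≢ (punchInᵢ≢i j l ∘ sym) | δ-refl j = sym (*-identityʳ (δ t l))
  ... | no j≢q rewrite δ-≢ (j≢q ∘ sym) | *-zeroʳ (δ t l) | +-identityʳ (δ q (punchIn j l)) = δ-punchOut j≢q l

  mergeColumn-collision : ∀ {q₁ q₂} → mergeColumn j t q₁ ≡ mergeColumn j t q₂ →
    q₁ ≡ q₂ ⊎ (q₁ ≡ j × q₂ ≡ punchIn j t) ⊎ (q₂ ≡ j × q₁ ≡ punchIn j t)
  mergeColumn-collision {q₁} {q₂} eq with j ≟ q₁ | j ≟ q₂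
  ... | yes refl | yes refl = inj₁ refl
  ... | yes refl | no j≢q₂  = inj₂ (inj₁ (refl , trans (sym (punchIn-punchOut j≢q₂)) (cong (punchIn j) (sym eq))))
  ... | no j≢q₁  | yes refl = inj₂ (inj₂ (refl , trans (sym (punchIn-punchOut j≢q₁)) (cong (punchIn j) eq)))
  ... | no j≢q₁  | no j≢q₂  = inj₁ (punchOut-injective j≢q₁ j≢q₂ eq)

  module _ {a : ℕ} where

    mergeAt : V a (suc b) → V a b
    mergeAt u = proj₁ u , mergeColumn j t (proj₂ u)

    rowCount-merge : ∀ S i → rowCount (map mergeAt S) i ≡ rowCount S i
    rowCount-merge S i = ∑-map mergeAt S (λ u → δ (proj₁ u) i)

    colCount-merge : ∀ S l → colCount (map mergeAt S) l ≡ colCount S (punchIn j l) + δ t l * colCount S j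
    colCount-merge S l = begin
      colCount (map mergeAt S) l
        ≡⟨ ∑-map mergeAt S (λ u → δ (proj₂ u) l) ⟩
      ∑ S (λ u → δ (mergeColumn j t (proj₂ u)) l)
        ≡⟨ ∑-cong S (λ u → δ-mergeColumn (proj₂ u) l) ⟩
      ∑ S (λ u → δ (proj₂ u) (punchIn j l) + δ t l * δ (proj₂ u) j)
        ≡⟨ ∑-+ S _ _ ⟩
      colCount S (punchIn j l) + ∑ S (λ u → δ t l * δ (proj₂ u) j)
        ≡⟨ cong (colCount S (punchIn j l) +_) (∑-*ˡ S (δ t l) (λ u → δ (proj₂ u) j)) ⟩
      colCount S (punchIn j l) + δ t l * colCount S j ∎
      where open ≡-Reasoning

    mult-merge : ∀ S i l → mult (map mergeAt S) i l ≡ mult S i (punchIn j l) + δ t l * mult S i j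
    mult-merge S i l = begin
      mult (map mergeAt S) i l
        ≡⟨ ∑-map mergeAt S (λ u → δ (proj₁ u) i * δ (proj₂ u) l) ⟩
      ∑ S (λ u → δ (proj₁ u) i * δ (mergeColumn j t (proj₂ u)) l)
        ≡⟨ ∑-cong S pointwise ⟩
      ∑ S (λ u → δ (proj₁ u) i * δ (proj₂ u) (punchIn j l) + δ t l * (δ (proj₁ u) i * δ (proj₂ u) j))
        ≡⟨ ∑-+ S _ _ ⟩
      mult S i (punchIn j l) + ∑ S (λ u → δ t l * (δ (proj₁ u) i * δ (proj₂ u) j))
        ≡⟨ cong (mult S i (punchIn j l) +_) (∑-*ˡ S (δ t l) (λ u → δ (proj₁ u) i * δ (proj₂ u) j)) ⟩
      mult S i (punchIn j l) + δ t l * mult S i j ∎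
      where
      open ≡-Reasoning
      pointwise : ∀ (u : V a (suc b)) → δ (proj₁ u) i * δ (mergeColumn j t (proj₂ u)) l
                  ≡ δ (proj₁ u) i * δ (proj₂ u) (punchIn j l) + δ t l * (δ (proj₁ u) i * δ (proj₂ u) j)
      pointwise (p , q) = begin
        δ p i * δ (mergeColumn j t q) l                 ≡⟨ cong (δ p i *_) (δ-mergeColumn q l) ⟩
        δ p i * (δ q (punchIn j l) + δ t l * δ q j)     ≡⟨ *-distribˡ-+ (δ p i) _ _ ⟩
        δ p i * δ q (punchIn j l) + δ p i * (δ t l * δ q j)
          ≡⟨ cong (δ p i * δ q (punchIn j l) +_) (x*[y*z]≡y*[x*z] (δ p i) (δ t l) (δ q j)) ⟩
        δ p i * δ q (punchIn j l) + δ t l * (δ p i * δ q j) ∎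

    merge-unique : ∀ S → Unique S → RowDisjoint S j (punchIn j t) → Unique (map mergeAt S)
    merge-unique S unique disjoint = map⁺-injectiveOn mergeAt S unique injective
      where
      conflict : ∀ i → (i , j) ∈ S → (i , punchIn j t) ∈ S → ⊥
      conflict i ∈j ∈t with disjoint i
      ... | inj₁ zero-j = 1+n≰n (subst (1 ≤_) zero-j (mult-∈ ∈j))
      ... | inj₂ zero-t = 1+n≰n (subst (1 ≤_) zero-t (mult-∈ ∈t))
      injective : ∀ {x y} → x ∈ S → y ∈ S → mergeAt x ≡ mergeAt y → x ≡ y
      injective {i , q₁} {i₂ , q₂} x∈S y∈S eq with cong proj₁ eq
      ... | refl with mergeColumn-collision (cong proj₂ eq)
      ...   | inj₁ refl                 = refl
      ...   | inj₂ (inj₁ (refl , refl)) = ⊥-elim (conflict i x∈S y∈S)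
      ...   | inj₂ (inj₂ (refl , refl)) = ⊥-elim (conflict i y∈S x∈S)

    merge-counts : ∀ S → Total2DomCounts S → RowDisjoint S j (punchIn j t) → Total2DomCounts (map mergeAt S)
    merge-counts S counts disjoint i l =
      subst₂ _≤_ (cong (λ m → 2 + (m + m)) (sym (mult-merge S i l)))
                 (sym (cong₂ _+_ (rowCount-merge S i) (colCount-merge S l)))
                 (bound (t ≟ l))
      where
      bound : (t≟l : Dec (t ≡ l)) →
        2 + ((mult S i (punchIn j l) + 𝟙 t≟l * mult S i j) + (mult S i (punchIn j l) + 𝟙 t≟l * mult S i j))
        ≤ rowCount S i + (colCount S (punchIn j l) + 𝟙 t≟l * colCount S j)
      bound (no _) rewrite +-identityʳ (mult S i (punchIn j l)) | +-identityʳ (colCount S (punchIn j l)) =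
        counts i (punchIn j l)
      bound (yes refl) rewrite +-identityʳ (mult S i j) | +-identityʳ (colCount S j) =
        disjoint-bound (rowCount S i) (colCount S (punchIn j t)) (colCount S j)
          (counts i (punchIn j t)) (counts i j) (disjoint i)
        where
        disjoint-bound : ∀ r c₁ c₂ {s₁ s₂} → 2 + (s₁ + s₁) ≤ r + c₁ → 2 + (s₂ + s₂) ≤ r + c₂ →
                         s₂ ≡ 0 ⊎ s₁ ≡ 0 → 2 + ((s₁ + s₂) + (s₁ + s₂)) ≤ r + (c₁ + c₂)
        disjoint-bound r c₁ c₂ {s₁} bound₁ _ (inj₁ refl) rewrite +-identityʳ s₁ =
          ≤-trans bound₁ (+-monoʳ-≤ r (m≤m+n c₁ c₂))
        disjoint-bound r c₁ c₂ _ bound₂ (inj₂ refl) = ≤-trans bound₂ (+-monoʳ-≤ r (m≤n+m c₂ c₁))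

    mergeColumns : ∀ S → Unique S → Total2DomCounts S → RowDisjoint S j (punchIn j t) →
                   Total2DomOfSize a b (length S)
    mergeColumns S unique counts disjoint =
      fromCounts (map mergeAt S) (merge-unique S unique disjoint) (merge-counts S counts disjoint) (length-map mergeAt S)

module _ {a b : ℕ} where

  sparseColumn⇒rows≥1 : ∀ (S : List (V a b)) → Total2DomCounts S → ∀ {j} → colCount S j ≤ 1 →
                        ∀ i → 1 ≤ rowCount S i
  sparseColumn⇒rows≥1 S counts {j} C≤1 i =
    s≤s⁻¹ (subst (2 ≤_) (+-comm (rowCount S i) 1) (≤-trans (2≤row+col S counts i j) (+-monoʳ-≤ (rowCount S i) C≤1)))

  sparseColumn-other-rows-empty : ∀ (S : List (V a b)) {j} → colCount S j ≤ 1 → ∀ {i₀} → 1 ≤ mult S i₀ j →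
                                  ∀ {i} → i ≢ i₀ → mult S i j ≡ 0
  sparseColumn-other-rows-empty S {j} C≤1 {i₀} 1≤mult₀ {i} i≢i₀ = n≤0⇒n≡0 (+-cancelʳ-≤ 1 (mult S i j) 0 (begin
    mult S i j + 1            ≤⟨ +-monoʳ-≤ (mult S i j) 1≤mult₀ ⟩
    mult S i j + mult S i₀ j  ≤⟨ entry+entry≤sum (λ i → mult S i j) i≢i₀ ⟩
    sum (λ i → mult S i j)    ≡⟨ colCount-as-sum S j ⟨
    colCount S j              ≤⟨ C≤1 ⟩
    1                         ∎))
    where open ≤-Reasoning

  emptyRow-large : ∀ (S : List (V a b)) → Total2DomCounts S → ∀ {i} → rowCount S i ≡ 0 → b + b ≤ length S
  emptyRow-large S counts {i} R≡0 =
    subst (b + b ≤_) (sym (length-cols S))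
      (k+k≤sum (λ l → subst (λ r → 2 ≤ r + colCount S l) R≡0 (2≤row+col S counts i l)))

fullRow-large : ∀ {a b} (S : List (V (suc a) b)) → Total2DomCounts S → ∀ {i j} → colCount S j ≤ 1 →
                (∀ l → 1 ≤ mult S i l) → b + a ≤ length S
fullRow-large {a} {b} S counts {i} C≤1 full =
  subst (b + a ≤_) (sym (length-rows S))
    (c+k≤sum (rowCount S) i (subst (b ≤_) (sym (rowCount-as-sum S i)) (k≤sum full))
      (sparseColumn⇒rows≥1 S counts C≤1 ∘ punchIn i))

sparseRows-large : ∀ {a b} (S : List (V (suc a) (suc b))) → Total2DomCounts S →
                   (∀ i → rowCount S i ≤ 1) → 3 + b ≤ length S
sparseRows-large {b = b} S counts R≤1 =
  let i , 1≤mult = positive-entry (λ i → mult S i zero)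
                     (subst (1 ≤_) (colCount-as-sum S zero) (≤-trans (s≤s z≤n) (col-bound zero zero)))
  in subst (3 + b ≤_) (sym (length-cols S))
       (c+k≤sum (colCount S) zero (≤-trans (s≤s (+-mono-≤ 1≤mult 1≤mult)) (col-bound zero i))
         (λ l → ≤-trans (s≤s z≤n) (col-bound (punchIn zero l) zero)))
  where
  col-bound : ∀ l i → 1 + (mult S i l + mult S i l) ≤ colCount S l
  col-bound l i = s≤s⁻¹ (≤-trans (counts i l) (+-monoˡ-≤ (colCount S l) (R≤1 i)))

mergeable⊎fullRow : ∀ {a b} (S : List (V a (suc (suc b)))) j → colCount S j ≤ 1 →
  (∃ λ t → RowDisjoint S j (punchIn j t)) ⊎ (∃ λ i → ∀ l → 1 ≤ mult S i l)
mergeable⊎fullRow S j C≤1 with colCount S j ℕ.≟ 0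
... | yes C≡0 = inj₁ (zero , λ i → inj₁ (n≤0⇒n≡0 (subst (mult S i j ≤_) C≡0 (mult≤colCount S i j))))
... | no C≢0 with positive-entry (λ i → mult S i j) (subst (1 ≤_) (colCount-as-sum S j) (n≢0⇒n>0 C≢0))
...   | i₀ , 1≤mult₀ with any? (λ t → mult S i₀ (punchIn j t) ℕ.≟ 0)
...     | yes (t , empty-t) = inj₁ (t , disjoint)
  where
  disjoint : RowDisjoint S j (punchIn j t)
  disjoint i with i ≟ i₀
  ... | yes refl = inj₂ empty-t
  ... | no i≢i₀  = inj₁ (sparseColumn-other-rows-empty S C≤1 1≤mult₀ i≢i₀)
...     | no none = inj₂ (i₀ , full)
  where
  full : ∀ l → 1 ≤ mult S i₀ l
  full l with j ≟ l
  ... | yes refl = 1≤mult₀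
  ... | no j≢l = subst (λ l′ → 1 ≤ mult S i₀ l′) (punchIn-punchOut j≢l)
                   (n≢0⇒n>0 (λ empty → none (punchOut j≢l , empty)))

shrinkSparseColumn : ∀ {a b c} (S : List (V (suc a) (suc (suc b)))) → Unique S → Total2DomCounts S →
  ∀ j → colCount S j ≤ 1 → c ≤ suc a → c ≤ suc b → c + c ≤ length S ⊎ Total2DomOfSize (suc a) (suc b) (length S)
shrinkSparseColumn {a} {b} S unique counts j C≤1 c≤a c≤b with mergeable⊎fullRow S j C≤1
... | inj₁ (t , disjoint) = inj₂ (mergeColumns j t S unique counts disjoint)
... | inj₂ (i , full) =
  inj₁ (≤-trans (+-mono-≤ c≤b c≤a) (subst (_≤ length S) (sym (+-suc (suc b) a)) (fullRow-large S counts C≤1 full)))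

shrinkColumns : ∀ {a b c k} → Total2DomOfSize (suc a) (suc (suc b)) k → c ≤ suc a → c ≤ suc b →
                c + c ≤ k ⊎ Total2DomOfSize (suc a) (suc b) k
shrinkColumns {a} {b} {c} (S , unique , t2d , refl) c≤a c≤b with all? (λ j → 2 ≤? colCount S j)
... | yes cols≥2 =
  inj₁ (≤-trans (+-mono-≤ (m≤n⇒m≤1+n c≤b) (m≤n⇒m≤1+n c≤b))
               (subst (_ ≤_) (sym (length-cols S)) (k+k≤sum cols≥2)))
... | no ¬cols≥2 with ¬∀⟶∃¬ _ _ (λ j → 2 ≤? colCount S j) ¬cols≥2
...   | j , C≱2 = shrinkSparseColumn S unique (T2D⇒counts S t2d) j (s≤s⁻¹ (≰⇒> C≱2)) c≤a c≤b

module _ {a b : ℕ} (i₀ : Fin a) (S : List (V a b)) where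

  withNewColumn : List (V a (suc b))
  withNewColumn = (i₀ , zero) ∷ map (map₂ suc) S

  private
    shift : V a b → V a (suc b)
    shift = map₂ suc

    rowCount-new : ∀ i → rowCount withNewColumn i ≡ δ i₀ i + rowCount S i
    rowCount-new i = cong (δ i₀ i +_) (∑-map shift S (λ u → δ (proj₁ u) i))

    colCount-new₀ : colCount withNewColumn zero ≡ 1
    colCount-new₀ = cong suc (trans (∑-map shift S (λ u → δ (proj₂ u) zero)) (∑-zero S))

    colCount-newₛ : ∀ l → colCount withNewColumn (suc l) ≡ colCount S l
    colCount-newₛ l = ∑-map shift S (λ u → δ (proj₂ u) (suc l))

    mult-new₀ : ∀ i → mult withNewColumn i zero ≡ δ i₀ i
    mult-new₀ i = trans (cong₂ _+_ (*-identityʳ (δ i₀ i)) rest-empty) (+-identityʳ (δ i₀ i))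
      where
      rest-empty : ∑ (map shift S) (λ u → δ (proj₁ u) i * δ (proj₂ u) zero) ≡ 0
      rest-empty = trans (∑-map shift S _) (trans (∑-cong S (λ u → *-zeroʳ (δ (proj₁ u) i))) (∑-zero S))

    mult-newₛ : ∀ i l → mult withNewColumn i (suc l) ≡ mult S i l
    mult-newₛ i l = cong₂ _+_ (*-zeroʳ (δ i₀ i)) (∑-map shift S (λ u → δ (proj₁ u) i * δ (proj₂ u) (suc l)))

  withNewColumn-unique : Unique S → Unique withNewColumn
  withNewColumn-unique unique =
    All.map⁺ (universal (λ { (p , q) () }) S) ∷ Unique.map⁺ (λ { {_ , _} {_ , _} refl → refl }) unique

  withNewColumn-counts : Total2DomCounts S → 2 ≤ rowCount S i₀ → (∀ i → 1 ≤ rowCount S i) →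
                         Total2DomCounts withNewColumn
  withNewColumn-counts counts 2≤R₀ rows≥1 i zero =
    subst₂ _≤_ (cong (λ m → 2 + (m + m)) (sym (mult-new₀ i))) (sym (cong₂ _+_ (rowCount-new i) colCount-new₀))
      (bound (i₀ ≟ i))
    where
    bound : (i₀≟i : Dec (i₀ ≡ i)) → 2 + (𝟙 i₀≟i + 𝟙 i₀≟i) ≤ 𝟙 i₀≟i + rowCount S i + 1
    bound (yes refl) = +-monoˡ-≤ 1 (s≤s 2≤R₀)
    bound (no _)     = +-monoˡ-≤ 1 (rows≥1 i)
  withNewColumn-counts counts 2≤R₀ rows≥1 i (suc l) =
    subst₂ _≤_ (cong (λ m → 2 + (m + m)) (sym (mult-newₛ i l))) (sym (cong₂ _+_ (rowCount-new i) (colCount-newₛ l)))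
      (≤-trans (counts i l) (+-monoˡ-≤ (colCount S l) (m≤n+m (rowCount S i) (δ i₀ i))))

addColumn : ∀ {a b k} → Total2DomOfSize (suc a) (suc b) k → a ≤ b →
            suc a + suc a ≤ k ⊎ Total2DomOfSize (suc a) (suc (suc b)) (k + 1)
addColumn {a} {b} (S , unique , t2d , refl) a≤b =
  extend (all? (λ i → 1 ≤? rowCount S i)) (any? (λ i → 2 ≤? rowCount S i))
  where
  counts : Total2DomCounts S
  counts = T2D⇒counts S t2d
  extend : Dec (∀ i → 1 ≤ rowCount S i) → Dec (∃ λ i → 2 ≤ rowCount S i) →
           suc a + suc a ≤ length S ⊎ Total2DomOfSize (suc a) (suc (suc b)) (length S + 1)
  extend (no ¬rows≥1) _ =
    let i , R≱1 = ¬∀⟶∃¬ _ _ (λ i → 1 ≤? rowCount S i) ¬rows≥1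
    in inj₁ (≤-trans (+-mono-≤ (s≤s a≤b) (s≤s a≤b)) (emptyRow-large S counts (n<1⇒n≡0 (≰⇒> R≱1))))
  extend (yes rows≥1) (yes (i₀ , 2≤R₀)) =
    inj₂ (fromCounts (withNewColumn i₀ S) (withNewColumn-unique i₀ S unique)
            (withNewColumn-counts i₀ S counts 2≤R₀ rows≥1)
            (trans (cong suc (length-map (map₂ suc) S)) (+-comm 1 (length S))))
  extend (yes _) (no noRow≥2) = ⊥-elim (1+n≰n (begin
    2 + b             ≤⟨ n≤1+n (2 + b) ⟩
    3 + b             ≤⟨ sparseRows-large S counts R≤1 ⟩
    length S          ≡⟨ length-rows S ⟩
    sum (rowCount S)  ≤⟨ sum≤k R≤1 ⟩
    suc a             ≤⟨ s≤s a≤b ⟩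
    suc b             ∎))
    where
    open ≤-Reasoning
    R≤1 : ∀ i → rowCount S i ≤ 1
    R≤1 i = s≤s⁻¹ (≰⇒> (λ 2≤R → noRow≥2 (i , 2≤R)))

module _ {a b : ℕ} (q₁ q₂ : Fin b) (S : List (V a b)) where

  withNewRow : List (V (suc a) b)
  withNewRow = (zero , q₁) ∷ (zero , q₂) ∷ map (map₁ suc) S

  private
    shift : V a b → V (suc a) b
    shift = map₁ suc

    rowCount-new₀ : rowCount withNewRow zero ≡ 2
    rowCount-new₀ = cong (2 +_) (trans (∑-map shift S (λ u → δ (proj₁ u) zero)) (∑-zero S))

    rowCount-newₛ : ∀ i → rowCount withNewRow (suc i) ≡ rowCount S i
    rowCount-newₛ i = ∑-map shift S (λ u → δ (proj₁ u) (suc i))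

    colCount-new : ∀ l → colCount withNewRow l ≡ δ q₁ l + (δ q₂ l + colCount S l)
    colCount-new l = cong (λ c → δ q₁ l + (δ q₂ l + c)) (∑-map shift S (λ u → δ (proj₂ u) l))

    mult-new₀ : ∀ l → mult withNewRow zero l ≡ δ q₁ l + δ q₂ l
    mult-new₀ l = trans (cong₂ _+_ (*-identityˡ (δ q₁ l)) (cong₂ _+_ (*-identityˡ (δ q₂ l)) rest-empty))
                        (cong (δ q₁ l +_) (+-identityʳ (δ q₂ l)))
      where
      rest-empty : ∑ (map shift S) (λ u → δ (proj₁ u) zero * δ (proj₂ u) l) ≡ 0
      rest-empty = trans (∑-map shift S _) (∑-zero S)

    mult-newₛ : ∀ i l → mult withNewRow (suc i) l ≡ mult S i l
    mult-newₛ i l = ∑-map shift S (λ u → δ (proj₁ u) (suc i) * δ (proj₂ u) l)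

  withNewRow-unique : Unique S → q₁ ≢ q₂ → Unique withNewRow
  withNewRow-unique unique q₁≢q₂ =
    ((q₁≢q₂ ∘ cong proj₂) ∷ new≢shifted) ∷ new≢shifted ∷
    Unique.map⁺ (λ { {_ , _} {_ , _} refl → refl }) unique
    where
    new≢shifted : ∀ {q} → All ((zero , q) ≢_) (map shift S)
    new≢shifted = All.map⁺ (universal (λ { (p , q) () }) S)

  withNewRow-counts : Total2DomCounts S → q₁ ≢ q₂ → 1 ≤ colCount S q₁ → 1 ≤ colCount S q₂ →
                      Total2DomCounts withNewRow
  withNewRow-counts counts q₁≢q₂ 1≤C₁ 1≤C₂ zero l =
    subst₂ _≤_ (cong (λ m → 2 + (m + m)) (sym (mult-new₀ l))) (sym (cong₂ _+_ rowCount-new₀ (colCount-new l)))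
      (s≤s (s≤s (subst (_≤ δ q₁ l + (δ q₂ l + colCount S l)) (sym (+-assoc (δ q₁ l) (δ q₂ l) _))
                  (+-monoʳ-≤ (δ q₁ l) (+-monoʳ-≤ (δ q₂ l) (bound (q₁ ≟ l) (q₂ ≟ l)))))))
    where
    bound : (q₁≟l : Dec (q₁ ≡ l)) (q₂≟l : Dec (q₂ ≡ l)) → 𝟙 q₁≟l + 𝟙 q₂≟l ≤ colCount S l
    bound (yes refl) (yes refl) = contradiction refl q₁≢q₂
    bound (yes refl) (no _)     = 1≤C₁
    bound (no _)     (yes refl) = 1≤C₂
    bound (no _)     (no _)     = z≤n
  withNewRow-counts counts _ _ _ (suc i) l =
    subst₂ _≤_ (cong (λ m → 2 + (m + m)) (sym (mult-newₛ i l))) (sym (cong₂ _+_ (rowCount-newₛ i) (colCount-new l)))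
      (≤-trans (counts i l) (+-monoʳ-≤ (rowCount S i) (≤-trans (m≤n+m _ (δ q₂ l)) (m≤n+m _ (δ q₁ l)))))

twoOccupiedColumns : ∀ {a b} (S : List (V (suc a) (suc (suc b)))) → IsTotal2Dom (suc a) (suc (suc b)) S →
                     ∃₂ λ u v → u ∈ S × v ∈ S × proj₂ u ≢ proj₂ v
twoOccupiedColumns S t2d with t2d (zero , zero)
... | (p , q) , _ , _ , u∈S , _ with t2d (p , punchIn q zero)
...   | w₁ , w₂ , w₁≢w₂ , w₁∈S , w₂∈S , adj₁ , adj₂ with proj₂ w₁ ≟ q | proj₂ w₂ ≟ q
...     | no q₁≢q | _      = (p , q) , w₁ , u∈S , w₁∈S , q₁≢q ∘ sym
...     | yes _   | no q₂≢q = (p , q) , w₂ , u∈S , w₂∈S , q₂≢q ∘ sym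
...     | yes q₁≡q | yes q₂≡q = contradiction (trans (pinned adj₁ q₁≡q) (sym (pinned adj₂ q₂≡q))) w₁≢w₂
  where
  pinned : ∀ {w} → Adj (p , punchIn q zero) w → proj₂ w ≡ q → w ≡ (p , q)
  pinned (inj₁ (refl , _)) refl = refl
  pinned (inj₂ (same-column , _)) w≡q = contradiction (trans same-column w≡q) (punchInᵢ≢i q zero)

addRow : ∀ {a b k} → Total2DomOfSize (suc a) (suc (suc b)) k → Total2DomOfSize (suc (suc a)) (suc (suc b)) (k + 2)
addRow (S , unique , t2d , refl) with twoOccupiedColumns S t2d
... | u , v , u∈S , v∈S , q₁≢q₂ =
  fromCounts (withNewRow (proj₂ u) (proj₂ v) S) (withNewRow-unique _ _ S unique q₁≢q₂)
    (withNewRow-counts _ _ S (T2D⇒counts S t2d) q₁≢q₂ (colCount-∈ u∈S) (colCount-∈ v∈S))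
    (trans (cong (2 +_) (length-map (map₁ suc) S)) (+-comm 2 (length S)))

γ≤size : ∀ {n m g k} → IsGamma2t n m g → Total2DomOfSize n m k → g ≤ k
γ≤size (_ , minimal) (T , unique , t2d , refl) = minimal T unique t2d

lemma2p5 : ∀ (n m : ℕ) → 2 ≤ n → n ≤ m →
    ∀ (g g₁ g₂ : ℕ) →
    IsGamma2t n m g → IsGamma2t n (suc m) g₁ → IsGamma2t (suc n) m g₂ →
    (g ≤ g₁ × g₁ ≤ g + 1) × (g ≤ g₂ × g₂ ≤ g + 2)
lemma2p5 (suc (suc a)) (suc (suc b)) (s≤s (s≤s z≤n)) n≤m@(s≤s (s≤s _)) g g₁ g₂ G G₁ G₂ =
  (g≤g₁ , g₁≤g+1) , (g≤g₂ , g₂≤g+2)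
  where
  g≤g₁ : g ≤ g₁
  g≤g₁ = [ ≤-trans (γ≤size G (twoFullColumns a b)) , γ≤size G ]′ (shrinkColumns (proj₁ G₁) ≤-refl n≤m)
  g≤g₂ : g ≤ g₂
  g≤g₂ = [ ≤-trans (γ≤size G (twoFullColumns a b)) , γ≤size G ∘ transpose ]′
           (shrinkColumns (transpose (proj₁ G₂)) n≤m ≤-refl)
  g₁≤g+1 : g₁ ≤ g + 1
  g₁≤g+1 = [ (λ 2n≤g → ≤-trans (γ≤size G₁ (twoFullColumns a (suc b))) (≤-trans 2n≤g (m≤m+n g 1)))
           , γ≤size G₁ ]′
             (addColumn (proj₁ G) (s≤s⁻¹ n≤m))
  g₂≤g+2 : g₂ ≤ g + 2
  g₂≤g+2 = γ≤size G₂ (addRow (proj₁ G))
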